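{- Let $\Delta$ be a FOL expressive dynamic theory with finite support. Then for every $\Delta$-formula $F$ there exists a first-order $\Delta$-formula $F_{FOL}$ such that $F\leftrightarrow F_{FOL}$ is $\Delta$-valid.
   Context: A dynamic theory $\Delta$ consists of: pairwise disjoint sets $\mathcal V,\mathcal A,\mathcal P$ (variables, atoms, programs); a nonempty set $U$; a nonempty set $S$ of states with $\mathrm{val}:S\times\mathcal V\to U$ satisfying interpolation (for all $\mu,\nu\in S$, $W\subseteq\mathcal V$ there is $\omega$ agreeing with $\mu$ on $W$ and with $\nu$ outside $W$); $\mathcal E_A:\mathcal A\to2^S$, $\mathrm{FV}_A$ with finite values and states agreeing on $\mathrm{FV}_A(a)$ both in or both out of $\mathcal E_A(a)$; $\mathcal E_P:\mathcal P\to2^{S\times S}$, $\mathrm{FV}_P$ with finite values, overapproximation (for $W\supseteq\mathrm{FV}_P(p)$, $\mu=_W\nu$, $(\mu,\omega)\in\mathcal E_P(p)$ there is $\tilde\omega$ with $(\nu,\tilde\omega)\in\mathcal E_P(p)$, $\omega=_W\tilde\omega$) and extensionality (if $\mu=_{\mathcal V}\nu$ then $(\mu,\omega)\in\mathcal E_P(p)\iff(\nu,\omega)\in\mathcal E_P(p)$); $\mu=_W\nu$ means equal values on all $v\in W$. Formulas $a\mid\neg F\mid F\wedge G\mid\forall vF\mid[p]F$, $\langle p\rangle F:=\neg[p]\neg F$, standard semantics ($[\![\forall vF]\!]$: all $\nu=_{\mathcal V\setminus\{v\}}\mu$ satisfy $F$; $[\![[p]F]\!]$: all $\mathcal E_P(p)$-successors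 satisfy $F$); valid = true in all states; first-order = no boxes. $\mathrm{FV}^{sem}(p)$: variables $v$ for which there exist $\mu=_{\mathcal V\setminus\{v\}}\tilde\mu$ and $(\mu,\nu)\in\mathcal E_P(p)$ with no $\tilde\nu=_{\mathcal V\setminus\{v\}}\nu$ such that $(\tilde\mu,\tilde\nu)\in\mathcal E_P(p)$; $\mathrm{BV}^{sem}(p)=\{v:\exists(\mu,\tilde\mu)\in\mathcal E_P(p),\mathrm{val}(\mu,v)\ne\mathrm{val}(\tilde\mu,v)\}$; $\mathrm{Vars}(p)=\mathrm{FV}^{sem}(p)\cup\mathrm{BV}^{sem}(p)$. Finite support: there is $\mathrm{BV}_P:\mathcal P\to2^{\mathcal V}$ with $\mathrm{BV}^{sem}(p)\subseteq\mathrm{BV}_P(p)$ and $\mathrm{BV}_P(p)$ finite for all $p$. Twin variables: $v,w$ with $\{\mathrm{val}(\mu,v):\mu\in S\}=\{\mathrm{val}(\mu,w):\mu\in S\}$; twin vectors: equal-length vectors of componentwise twins. FOL expressive (for $\Delta$ with finite support): (1) every variable has infinitely many twin variables; (2) there is a map $\doteq:\mathcal V^2\to$ first-order formulas with $\mu\models v\doteq w$ iff $\mathrm{val}(\mu,v)=\mathrm{val}(\mu,w)$, for all twin variables $v,w$ and states $\mu$; (3) rendition: there is a map $\mathrm S$ such that for every program $p$ and twin vectors $\underline v,\underline v^+$ with $\underline v\supseteq\mathrm{Vars}(p)$ and $\underline v\cap\underline v^+=\emptyset$, $\mathrm S_p(\underline v,\underline v^+)$ is a first-order formula and $\mathrm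 S_p(\underline v,\underline v^+)\leftrightarrow\langle p\rangle(\underline v\doteq\underline v^+)$ is $\Delta$-valid (where $\underline v\doteq\underline v^+$ is the componentwise conjunction). -}

module Defs where

open import Data.Empty using (⊥)
open import Data.Unit using (⊤)
open import Data.Product using (Σ; Σ-syntax; _×_; _,_)
open import Data.List using (List)
open import Data.List.Membership.Propositional using (_∈_; _∉_)
open import Data.List.Relation.Binary.Pointwise using (Pointwise)
open import Relation.Nullary using (¬_)
open import Relation.Binary.PropositionalEquality using (_≡_; _≢_)
open import Function.Bundles using (_⇔_)

-- Syntax: formulas over variables V, atoms A, programs P
-- (V, A, P are separate types, hence pairwise disjoint.)

data Formula (V A P : Set) : Set where
  atom : A → Formula V A P
  ¬f_  : Formula V A P → Formula V A P
  _∧f_ : Formula V A P → Formula V A P → Formula V A P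
  ∀f   : V → Formula V A P → Formula V A P
  box  : P → Formula V A P → Formula V A P

module _ {V A P : Set} where
  dia : P → Formula V A P → Formula V A P
  dia p F = ¬f (box p (¬f F))

  _⇒f_ : Formula V A P → Formula V A P → Formula V A P
  F ⇒f G = ¬f (F ∧f (¬f G))

  _⇔f_ : Formula V A P → Formula V A P → Formula V A P
  F ⇔f G = (F ⇒f G) ∧f (G ⇒f F)

  FirstOrder : Formula V A P → Set
  FirstOrder (atom a) = ⊤
  FirstOrder (¬f F) = FirstOrder F
  FirstOrder (F ∧f G) = FirstOrder F × FirstOrder G
  FirstOrder (∀f v F) = FirstOrder F
  FirstOrder (box p F) = ⊥

-- Dynamic theories. Subsets of V are predicates V → Set;
-- finite sets of variables are lists.

record DynamicTheory : Set₁ where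
  field
    V A P U S : Set
    someU : U
    someS : S
    val : S → V → U

  Agree : S → (V → Set) → S → Set
  Agree μ W ν = ∀ v → W v → val μ v ≡ val ν v

  AgreeExcept : S → V → S → Set
  AgreeExcept μ v ν = ∀ w → w ≢ v → val μ w ≡ val ν w

  field
    interpolation : ∀ (μ ν : S) (W : V → Set) →
      Σ[ ω ∈ S ] (Agree ω W μ × (∀ v → ¬ W v → val ω v ≡ val ν v))
    EA  : A → S → Set
    FVA : A → List V
    coincidenceA : ∀ a μ ν → Agree μ (λ v → v ∈ FVA a) ν → (EA a μ ⇔ EA a ν)
    EP  : P → S → S → Set
    FVP : P → List V
    overapprox : ∀ p (W : V → Set) → (∀ v → v ∈ FVP p → W v) →
      ∀ μ ν ω → Agree μ W ν → EP p μ ω →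
      Σ[ ω̃ ∈ S ] (EP p ν ω̃ × Agree ω W ω̃)
    extensionality : ∀ p μ ν ω → Agree μ (λ _ → ⊤) ν → (EP p μ ω ⇔ EP p ν ω)

  Fml : Set
  Fml = Formula V A P

  _⊨_ : S → Fml → Set
  μ ⊨ atom a = EA a μ
  μ ⊨ (¬f F) = ¬ (μ ⊨ F)
  μ ⊨ (F ∧f G) = (μ ⊨ F) × (μ ⊨ G)
  μ ⊨ ∀f v F = ∀ ν → AgreeExcept ν v μ → ν ⊨ F
  μ ⊨ box p F = ∀ ν → EP p μ ν → ν ⊨ F

  Valid : Fml → Set
  Valid F = ∀ μ → μ ⊨ F

  FVsem : P → V → Set
  FVsem p v = Σ[ μ ∈ S ] Σ[ μ̃ ∈ S ] Σ[ ν ∈ S ]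
    (AgreeExcept μ v μ̃ × EP p μ ν ×
     ¬ (Σ[ ν̃ ∈ S ] (AgreeExcept ν̃ v ν × EP p μ̃ ν̃)))

  BVsem : P → V → Set
  BVsem p v = Σ[ μ ∈ S ] Σ[ μ̃ ∈ S ] (EP p μ μ̃ × val μ v ≢ val μ̃ v)

  Vars : P → V → Set
  Vars p v = FVsem p v ⊎' BVsem p v
    where
    open import Data.Sum using () renaming (_⊎_ to _⊎'_)

  Twin : V → V → Set
  Twin v w = ∀ (u : U) → (Σ[ μ ∈ S ] val μ v ≡ u) ⇔ (Σ[ μ ∈ S ] val μ w ≡ u)

  TwinVec : List V → List V → Set
  TwinVec = Pointwise Twin

record FiniteSupport (Δ : DynamicTheory) : Set where
  open DynamicTheory Δ
  field
    BVP : P → List V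
    BVsem⊆BVP : ∀ p v → BVsem p v → v ∈ BVP p

record FOLExpressive (Δ : DynamicTheory) : Set where
  open DynamicTheory Δ
  field
    -- (1) infinitely many twins: every finite list misses some twin
    manyTwins : ∀ v (l : List V) → Σ[ w ∈ V ] (Twin v w × w ∉ l)
    eqF : V → V → Fml
    eqF-FO : ∀ v w → FirstOrder (eqF v w)
    eqF-sem : ∀ v w → Twin v w → ∀ μ → (μ ⊨ eqF v w) ⇔ (val μ v ≡ val μ w)

  -- μ ⊨ v ≐ v⁺ (componentwise conjunction; empty conjunction is true)
  SatEqVec : S → List V → List V → Set
  SatEqVec μ vs ws = Pointwise (λ v w → μ ⊨ eqF v w) vs ws

  -- μ ⊨ ⟨p⟩(v ≐ v⁺), via ⟨p⟩G := ¬[p]¬G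
  SatDiaEq : S → P → List V → List V → Set
  SatDiaEq μ p vs ws = ¬ (∀ ν → EP p μ ν → ¬ SatEqVec ν vs ws)

  field
    rend : P → List V → List V → Fml
    rend-FO : ∀ p vs ws → TwinVec vs ws → (∀ x → Vars p x → x ∈ vs) →
      (∀ x → x ∈ vs → x ∉ ws) → FirstOrder (rend p vs ws)
    rend-valid : ∀ p vs ws → TwinVec vs ws → (∀ x → Vars p x → x ∈ vs) →
      (∀ x → x ∈ vs → x ∉ ws) →
      ∀ μ → (μ ⊨ rend p vs ws) ⇔ SatDiaEq μ p vs ws

{-# OPTIONS --safe #-}
-- By induction on the formula it suffices to eliminate a box [p]G whose body G is already
-- first-order.  Let v̄ list FV(p), a finite bound for BV(p) and the free variables of G, and
-- let v̄⁺ be fresh twins of v̄.  Then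
--   [p]G  ↔  ∀v̄⁺ (S_p(v̄, v̄⁺) → ∀v̄ (v̄ ≐ v̄⁺ → G)).
-- Since p neither reads nor writes v̄⁺, changing v̄⁺ does not change which runs of p are
-- possible; so the values that S_p lets v̄⁺ take are exactly the values of v̄ after some run
-- of p, and loading them back into v̄ yields a state agreeing with that p-successor on the
-- free variables of G.
module Submission where

open import Defs
open import Level using (0ℓ)
open import Data.Product using (Σ-syntax; _×_)
open import Axiom.ExcludedMiddle using (ExcludedMiddle)

open import Axiom.DoubleNegationElimination using (em⇒dne)
open import Data.Product using (_,_)
open import Data.Product.Function.NonDependent.Propositional using (_×-⇔_)
open import Data.Sum using (inj₁; inj₂)
open import Data.Unit using (tt)
open import Data.List using (List; []; _∷_; _++_; foldr)
open import Data.List.Membership.Propositional using (_∈_; _∉_)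
open import Data.List.Membership.Propositional.Properties using (∈-++⁺ˡ; ∈-++⁺ʳ)
open import Data.List.Relation.Unary.Any using (here; there)
open import Data.List.Relation.Unary.All using (lookup)
open import Data.List.Relation.Unary.All.Properties using (¬Any⇒All¬)
open import Data.List.Relation.Unary.Unique.Propositional using (Unique; []; _∷_)
open import Data.List.Relation.Binary.Disjoint.Propositional using (Disjoint)
open import Data.List.Relation.Binary.Pointwise using (Pointwise; []; _∷_)
open import Function.Base using (_∘_)
open import Function.Bundles using (_⇔_; mk⇔; Equivalence)
open import Function.Construct.Composition using (_⇔-∘_)
open import Function.Construct.Identity using (⇔-id)
open import Function.Related.TypeIsomorphisms using (¬-cong-⇔)
open import Relation.Nullary using (¬_; yes; no)
open import Relation.Binary.PropositionalEquality using (_≡_; _≢_; refl; sym; trans; subst)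

open Equivalence using (to; from)

∀-cong-⇔ : {A : Set} {R P Q : A → Set} → (∀ x → P x ⇔ Q x) →
  (∀ x → R x → P x) ⇔ (∀ x → R x → Q x)
∀-cong-⇔ P⇔Q = mk⇔ (λ h x r → to (P⇔Q x) (h x r)) (λ h x r → from (P⇔Q x) (h x r))

module Semantics (em : ExcludedMiddle 0ℓ) (Δ : DynamicTheory) where
  open DynamicTheory Δ

  dne : {Q : Set} → ¬ ¬ Q → Q
  dne = em⇒dne em

  Agree-sym : ∀ {μ W ν} → Agree μ W ν → Agree ν W μ
  Agree-sym μ≈ν x x∈W = sym (μ≈ν x x∈W)

  Agree-by-cases : ∀ {μ ν} v (W : V → Set) → (W v → val μ v ≡ val ν v) →
    (∀ x → x ≢ v → W x → val μ x ≡ val ν x) → Agree μ W ν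
  Agree-by-cases v W at-v off-v x x∈W with em {x ≡ v}
  ... | yes refl = at-v x∈W
  ... | no x≢v = off-v x x≢v x∈W

  ⊨-⇒f : ∀ {μ} F G → μ ⊨ (F ⇒f G) ⇔ (μ ⊨ F → μ ⊨ G)
  ⊨-⇒f F G = mk⇔ (λ h μF → dne λ ¬μG → h (μF , ¬μG)) (λ f (μF , ¬μG) → ¬μG (f μF))

  infix 4 _≋_

  _≋_ : Fml → Fml → Set
  F ≋ G = ∀ μ → μ ⊨ F ⇔ μ ⊨ G

  ≋⇒Valid-⇔f : ∀ {F G} → F ≋ G → Valid (F ⇔f G)
  ≋⇒Valid-⇔f {F} {G} F≋G μ = from (⊨-⇒f F G) (to (F≋G μ)) , from (⊨-⇒f G F) (from (F≋G μ))

  ≋-∀f : ∀ v {F G} → F ≋ G → ∀f v F ≋ ∀f v G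
  ≋-∀f v F≋G μ = ∀-cong-⇔ F≋G

  ≋-box : ∀ p {F G} → F ≋ G → box p F ≋ box p G
  ≋-box p F≋G μ = ∀-cong-⇔ F≋G

  -- Only meaningful for first-order formulas: boxes are given no free variables.
  FV : Fml → List V
  FV (atom a) = FVA a
  FV (¬f F) = FV F
  FV (F ∧f G) = FV F ++ FV G
  FV (∀f v F) = FV F
  FV (box p F) = []

  ⊨-coincidence : ∀ F → FirstOrder F → ∀ {μ ν} → Agree μ (_∈ FV F) ν → μ ⊨ F → ν ⊨ F
  ⊨-coincidence (atom a) _ μ≈ν = to (coincidenceA a _ _ μ≈ν)
  ⊨-coincidence (¬f F) fo μ≈ν ¬μF νF = ¬μF (⊨-coincidence F fo (Agree-sym μ≈ν) νF)
  ⊨-coincidence (F ∧f G) (foF , foG) μ≈ν (μF , μG) =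
    ⊨-coincidence F foF (λ x → μ≈ν x ∘ ∈-++⁺ˡ) μF ,
    ⊨-coincidence G foG (λ x → μ≈ν x ∘ ∈-++⁺ʳ (FV F)) μG
  ⊨-coincidence (∀f v F) fo {μ} {ν} μ≈ν μ⊨∀vF ν′ ν′≈ν with interpolation ν′ μ (_≡ v)
  ... | ω , ω≈ν′ , ω≈μ = ⊨-coincidence F fo ω≈ν′-on-FV (μ⊨∀vF ω ω≈μ)
    where
    ω≈ν′-on-FV : Agree ω (_∈ FV F) ν′
    ω≈ν′-on-FV = Agree-by-cases v _ (λ _ → ω≈ν′ v refl) λ x x≢v x∈FV →
      trans (ω≈μ x x≢v) (trans (μ≈ν x x∈FV) (sym (ν′≈ν x x≢v)))

  ∀* : List V → Fml → Fml
  ∀* vs F = foldr ∀f F vs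

  ∀*-FirstOrder : ∀ vs {F} → FirstOrder F → FirstOrder (∀* vs F)
  ∀*-FirstOrder [] fo = fo
  ∀*-FirstOrder (_ ∷ vs) fo = ∀*-FirstOrder vs fo

  ⊨-∀* : ∀ vs F → FirstOrder F → ∀ {μ} →
    μ ⊨ ∀* vs F ⇔ (∀ ν → Agree ν (_∉ vs) μ → ν ⊨ F)
  ⊨-∀* [] F fo {μ} = mk⇔
    (λ μF ν ν≈μ → ⊨-coincidence F fo (λ x _ → sym (ν≈μ x λ ())) μF)
    (λ h → h μ (λ _ _ → refl))
  ⊨-∀* (v ∷ vs) F fo {μ} = mk⇔ elim intro
    where
    elim : μ ⊨ ∀* (v ∷ vs) F → ∀ ν → Agree ν (_∉ v ∷ vs) μ → ν ⊨ F
    elim h ν ν≈μ with interpolation ν μ (_≡ v)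
    ... | ω , ω≈ν , ω≈μ = to (⊨-∀* vs F fo) (h ω ω≈μ) ν
      (Agree-by-cases v _ (λ _ → sym (ω≈ν v refl)) λ x x≢v x∉vs →
        trans (ν≈μ x λ { (here x≡v) → x≢v x≡v ; (there x∈vs) → x∉vs x∈vs }) (sym (ω≈μ x x≢v)))

    intro : (∀ ν → Agree ν (_∉ v ∷ vs) μ → ν ⊨ F) → μ ⊨ ∀* (v ∷ vs) F
    intro h ν ν≈μ = from (⊨-∀* vs F fo) λ ν₁ ν₁≈ν →
      h ν₁ λ x x∉ → trans (ν₁≈ν x (x∉ ∘ there)) (ν≈μ x (x∉ ∘ here))

  Matches : S → List V → S → List V → Set
  Matches σ vs τ ws = Pointwise (λ v w → val σ v ≡ val τ w) vs ws

  Matches-cong : ∀ {σ σ′ τ τ′ vs ws} → Agree σ (_∈ vs) σ′ → Agree τ (_∈ ws) τ′ →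
    Matches σ vs τ ws → Matches σ′ vs τ′ ws
  Matches-cong σ≈σ′ τ≈τ′ [] = []
  Matches-cong σ≈σ′ τ≈τ′ (e ∷ es) =
    trans (sym (σ≈σ′ _ (here refl))) (trans e (τ≈τ′ _ (here refl))) ∷
    Matches-cong (λ x → σ≈σ′ x ∘ there) (λ x → τ≈τ′ x ∘ there) es

  Matches⇒Agree : ∀ {σ ρ τ vs ws} → Matches σ vs τ ws → Matches ρ vs τ ws → Agree σ (_∈ vs) ρ
  Matches⇒Agree (e ∷ _) (e′ ∷ _) x (here refl) = trans e (sym e′)
  Matches⇒Agree (_ ∷ es) (_ ∷ es′) x (there x∈vs) = Matches⇒Agree es es′ x x∈vs

  assignTwins : ∀ {vs ws} → TwinVec vs ws → Unique ws → ∀ ν μ →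
    Σ[ μ′ ∈ S ] (Agree μ′ (_∉ ws) μ × Matches ν vs μ′ ws)
  assignTwins [] [] ν μ = μ , (λ _ _ → refl) , []
  assignTwins {v ∷ vs} {w ∷ ws} (twin ∷ twins) (w∉ws ∷ unique) ν μ
    with assignTwins twins unique ν μ | to (twin (val ν v)) (ν , refl)
  ... | τ , τ≈μ , matches | σ , σw≡νv with interpolation σ τ (_≡ w)
  ... | ω , ω≈σ , ω≈τ =
    ω , ω≈μ , trans (sym σw≡νv) (sym (ω≈σ w refl)) ∷ Matches-cong (λ _ _ → refl) τ≈ω matches
    where
    ω≈μ : Agree ω (_∉ w ∷ ws) μ
    ω≈μ x x∉ = trans (ω≈τ x (x∉ ∘ here)) (τ≈μ x (x∉ ∘ there))

    τ≈ω : Agree τ (_∈ ws) ω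
    τ≈ω x x∈ws = sym (ω≈τ x λ x≡w → lookup w∉ws x∈ws (sym x≡w))

  FVsem⊆FVP : ∀ p x → FVsem p x → x ∈ FVP p
  FVsem⊆FVP p x (μ , μ̃ , ν , μ≈μ̃ , step , no-variant-step) = dne λ x∉FVP →
    let ν̃ , step̃ , ν≈ν̃ = overapprox p (_≢ x) (λ y y∈FVP y≡x → x∉FVP (subst (_∈ FVP p) y≡x y∈FVP))
                            μ μ̃ ν μ≈μ̃ step
    in no-variant-step (ν̃ , Agree-sym ν≈ν̃ , step̃)

module Elimination (em : ExcludedMiddle 0ℓ) (Δ : DynamicTheory)
                   (fs : FiniteSupport Δ) (fe : FOLExpressive Δ) where
  open DynamicTheory Δ
  open FiniteSupport fs
  open FOLExpressive fe
  open Semantics em Δ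

  EP-Agree-∉BVP : ∀ {p μ ν} → EP p μ ν → Agree μ (_∉ BVP p) ν
  EP-Agree-∉BVP {p} {μ} {ν} step x x∉BVP =
    dne λ μx≢νx → x∉BVP (BVsem⊆BVP p x (μ , ν , step , μx≢νx))

  record FreshTwins (vs avoid : List V) : Set where
    field
      fresh  : List V
      twins  : TwinVec vs fresh
      unique : Unique fresh
      avoids : Disjoint fresh avoid

  freshTwins : ∀ vs avoid → FreshTwins vs avoid
  freshTwins [] avoid = record { fresh = [] ; twins = [] ; unique = [] ; avoids = λ { (() , _) } }
  freshTwins (v ∷ vs) avoid with freshTwins vs avoid
  ... | record { fresh = ws ; twins = twins ; unique = unique ; avoids = avoids }
    with manyTwins v (avoid ++ ws)
  ... | w , twin , w∉ = record
    { fresh = w ∷ ws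
    ; twins = twin ∷ twins
    ; unique = ¬Any⇒All¬ ws (w∉ ∘ ∈-++⁺ʳ avoid) ∷ unique
    ; avoids = λ { (here refl , w∈avoid) → w∉ (∈-++⁺ˡ w∈avoid)
                 ; (there x∈ws , x∈avoid) → avoids (x∈ws , x∈avoid) }
    }

  SatEqVec⇔Matches : ∀ {vs ws μ} → TwinVec vs ws → SatEqVec μ vs ws ⇔ Matches μ vs μ ws
  SatEqVec⇔Matches [] = mk⇔ (λ { [] → [] }) (λ { [] → [] })
  SatEqVec⇔Matches {v ∷ vs} {w ∷ ws} {μ} (twin ∷ twins) = mk⇔
    (λ { (e ∷ es) → to (eqF-sem v w twin μ) e ∷ to (SatEqVec⇔Matches twins) es })
    (λ { (e ∷ es) → from (eqF-sem v w twin μ) e ∷ from (SatEqVec⇔Matches twins) es })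

  _≐*_⇒f_ : List V → List V → Fml → Fml
  (v ∷ vs) ≐* (w ∷ ws) ⇒f G = eqF v w ⇒f (vs ≐* ws ⇒f G)
  _ ≐* _ ⇒f G = G

  ≐*⇒f-FirstOrder : ∀ vs ws {G} → FirstOrder G → FirstOrder (vs ≐* ws ⇒f G)
  ≐*⇒f-FirstOrder (v ∷ vs) (w ∷ ws) fo = eqF-FO v w , ≐*⇒f-FirstOrder vs ws fo
  ≐*⇒f-FirstOrder [] _ fo = fo
  ≐*⇒f-FirstOrder (_ ∷ _) [] fo = fo

  ⊨-≐*⇒f : ∀ {vs ws μ} G → TwinVec vs ws → μ ⊨ (vs ≐* ws ⇒f G) ⇔ (Matches μ vs μ ws → μ ⊨ G)
  ⊨-≐*⇒f G [] = mk⇔ (λ μG _ → μG) (λ h → h [])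
  ⊨-≐*⇒f {v ∷ vs} {w ∷ ws} {μ} G (twin ∷ twins) = mk⇔
    (λ { h (e ∷ es) → to (⊨-≐*⇒f G twins) (to ⊨head h (from (eqF-sem v w twin μ) e)) es })
    (λ h → from ⊨head λ μ⊨v≐w → from (⊨-≐*⇒f G twins) λ es → h (to (eqF-sem v w twin μ) μ⊨v≐w ∷ es))
    where
    ⊨head : μ ⊨ (eqF v w ⇒f (vs ≐* ws ⇒f G)) ⇔ (μ ⊨ eqF v w → μ ⊨ (vs ≐* ws ⇒f G))
    ⊨head = ⊨-⇒f (eqF v w) (vs ≐* ws ⇒f G)

  module _ (p : P) (G : Fml) where
    vs : List V
    vs = FVP p ++ BVP p ++ FV G

    open FreshTwins (freshTwins vs vs) renaming (fresh to ws)

    Load : Fml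
    Load = ∀* vs (vs ≐* ws ⇒f G)

    Body : Fml
    Body = rend p vs ws ⇒f Load

    elimBox : Fml
    elimBox = ∀* ws Body

    vs∌ws : ∀ {x} → x ∈ vs → x ∉ ws
    vs∌ws x∈vs x∈ws = avoids (x∈ws , x∈vs)

    ws∌vs : ∀ {x} → x ∈ ws → x ∉ vs
    ws∌vs x∈ws x∈vs = avoids (x∈ws , x∈vs)

    ws∌BVP : ∀ {x} → x ∈ ws → x ∉ BVP p
    ws∌BVP x∈ws = ws∌vs x∈ws ∘ ∈-++⁺ʳ (FVP p) ∘ ∈-++⁺ˡ

    FV⊆vs : ∀ {x} → x ∈ FV G → x ∈ vs
    FV⊆vs = ∈-++⁺ʳ (FVP p) ∘ ∈-++⁺ʳ (BVP p)

    Vars⊆vs : ∀ x → Vars p x → x ∈ vs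
    Vars⊆vs x (inj₁ x∈FVsem) = ∈-++⁺ˡ (FVsem⊆FVP p x x∈FVsem)
    Vars⊆vs x (inj₂ x∈BVsem) = ∈-++⁺ʳ (FVP p) (∈-++⁺ˡ (BVsem⊆BVP p x x∈BVsem))

    EP-transfer : ∀ {μ μ′ ν} → Agree μ (_∉ ws) μ′ → EP p μ ν →
      Σ[ ν′ ∈ S ] (EP p μ′ ν′ × Agree ν (_∉ ws) ν′)
    EP-transfer = overapprox p (_∉ ws) (λ _ → vs∌ws ∘ ∈-++⁺ˡ) _ _ _

    ⊨-rend : ∀ {μ} → μ ⊨ rend p vs ws ⇔ (Σ[ ν ∈ S ] (EP p μ ν × Matches ν vs ν ws))
    ⊨-rend {μ} = mk⇔
      (λ r → dne λ no-run →
        to rend⇔ r λ ν step eqs → no-run (ν , step , to (SatEqVec⇔Matches twins) eqs))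
      (λ (ν , step , m) → from rend⇔ λ no-run → no-run ν step (from (SatEqVec⇔Matches twins) m))
      where
      rend⇔ : μ ⊨ rend p vs ws ⇔ SatDiaEq μ p vs ws
      rend⇔ = rend-valid p vs ws twins Vars⊆vs (λ _ → vs∌ws) μ

    Body-FirstOrder : FirstOrder G → FirstOrder Body
    Body-FirstOrder fo = rend-FO p vs ws twins Vars⊆vs (λ _ → vs∌ws) ,
                         ∀*-FirstOrder vs (≐*⇒f-FirstOrder vs ws fo)

    elimBox-FirstOrder : FirstOrder G → FirstOrder elimBox
    elimBox-FirstOrder fo = ∀*-FirstOrder ws (Body-FirstOrder fo)

    -- μ₁ stores in ws the values of vs after a run of p, and μ₂ loads them back into vs.
    BoxCondition : S → Set
    BoxCondition μ = ∀ μ₁ → Agree μ₁ (_∉ ws) μ → ∀ ν → EP p μ₁ ν → Matches ν vs ν ws →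
                     ∀ μ₂ → Agree μ₂ (_∉ vs) μ₁ → Matches μ₂ vs μ₂ ws → μ₂ ⊨ G

    BoxCondition⇔⊨elimBox : FirstOrder G → ∀ {μ} → BoxCondition μ ⇔ μ ⊨ elimBox
    BoxCondition⇔⊨elimBox fo = mk⇔
      (λ c → from ⊨elimBox λ μ₁ μ₁≈μ → from ⊨Body λ r →
        let ν , step , m = to ⊨-rend r
        in from ⊨Load λ μ₂ μ₂≈μ₁ → from ⊨Eqs (c μ₁ μ₁≈μ ν step m μ₂ μ₂≈μ₁))
      (λ h μ₁ μ₁≈μ ν step m μ₂ μ₂≈μ₁ →
        to ⊨Eqs (to ⊨Load (to ⊨Body (to ⊨elimBox h μ₁ μ₁≈μ) (from ⊨-rend (ν , step , m))) μ₂ μ₂≈μ₁))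
      where
      ⊨elimBox : ∀ {μ} → μ ⊨ elimBox ⇔ (∀ μ₁ → Agree μ₁ (_∉ ws) μ → μ₁ ⊨ Body)
      ⊨elimBox = ⊨-∀* ws Body (Body-FirstOrder fo)

      ⊨Body : ∀ {μ} → μ ⊨ Body ⇔ (μ ⊨ rend p vs ws → μ ⊨ Load)
      ⊨Body = ⊨-⇒f (rend p vs ws) Load

      ⊨Load : ∀ {μ} → μ ⊨ Load ⇔ (∀ μ₂ → Agree μ₂ (_∉ vs) μ → μ₂ ⊨ (vs ≐* ws ⇒f G))
      ⊨Load = ⊨-∀* vs (vs ≐* ws ⇒f G) (≐*⇒f-FirstOrder vs ws fo)

      ⊨Eqs : ∀ {μ} → μ ⊨ (vs ≐* ws ⇒f G) ⇔ (Matches μ vs μ ws → μ ⊨ G)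
      ⊨Eqs = ⊨-≐*⇒f G twins

    box⇒BoxCondition : FirstOrder G → ∀ {μ} → μ ⊨ box p G → BoxCondition μ
    box⇒BoxCondition fo □G μ₁ μ₁≈μ ν step m μ₂ μ₂≈μ₁ m₂ with EP-transfer μ₁≈μ step
    ... | ν′ , step′ , ν≈ν′ = ⊨-coincidence G fo ν′≈μ₂ (□G ν′ step′)
      where
      ν≈μ₂-on-ws : Agree ν (_∈ ws) μ₂
      ν≈μ₂-on-ws x x∈ws = sym (trans (μ₂≈μ₁ x (ws∌vs x∈ws)) (EP-Agree-∉BVP step x (ws∌BVP x∈ws)))

      ν≈μ₂ : Agree ν (_∈ vs) μ₂
      ν≈μ₂ = Matches⇒Agree (Matches-cong (λ _ _ → refl) ν≈μ₂-on-ws m) m₂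

      ν′≈μ₂ : Agree ν′ (_∈ FV G) μ₂
      ν′≈μ₂ x x∈FV = trans (sym (ν≈ν′ x (vs∌ws (FV⊆vs x∈FV)))) (ν≈μ₂ x (FV⊆vs x∈FV))

    BoxCondition⇒box : FirstOrder G → ∀ {μ} → BoxCondition μ → μ ⊨ box p G
    BoxCondition⇒box fo {μ} c ν step with assignTwins twins unique ν μ
    ... | μ₁ , μ₁≈μ , m₁ with EP-transfer (Agree-sym μ₁≈μ) step | interpolation ν μ₁ (_∈ vs)
    ... | ν′ , step′ , ν≈ν′ | μ₂ , μ₂≈ν , μ₂≈μ₁ =
      ⊨-coincidence G fo (λ x → μ₂≈ν x ∘ FV⊆vs) (c μ₁ μ₁≈μ ν′ step′ m′ μ₂ μ₂≈μ₁ m₂)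
      where
      m′ : Matches ν′ vs ν′ ws
      m′ = Matches-cong (λ x → ν≈ν′ x ∘ vs∌ws) (λ x → EP-Agree-∉BVP step′ x ∘ ws∌BVP) m₁

      m₂ : Matches μ₂ vs μ₂ ws
      m₂ = Matches-cong (Agree-sym μ₂≈ν) (λ x → sym ∘ μ₂≈μ₁ x ∘ ws∌vs) m₁

    box≋elimBox : FirstOrder G → box p G ≋ elimBox
    box≋elimBox fo μ = BoxCondition⇔⊨elimBox fo ⇔-∘ mk⇔ (box⇒BoxCondition fo) (BoxCondition⇒box fo)

  fol : Fml → Fml
  fol (atom a) = atom a
  fol (¬f F) = ¬f fol F
  fol (F ∧f G) = fol F ∧f fol G
  fol (∀f v F) = ∀f v (fol F)
  fol (box p F) = elimBox p (fol F)

  fol-FirstOrder : ∀ F → FirstOrder (fol F)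
  fol-FirstOrder (atom a) = tt
  fol-FirstOrder (¬f F) = fol-FirstOrder F
  fol-FirstOrder (F ∧f G) = fol-FirstOrder F , fol-FirstOrder G
  fol-FirstOrder (∀f v F) = fol-FirstOrder F
  fol-FirstOrder (box p F) = elimBox-FirstOrder p (fol F) (fol-FirstOrder F)

  ≋-fol : ∀ F → F ≋ fol F
  ≋-fol (atom a) μ = ⇔-id _
  ≋-fol (¬f F) μ = ¬-cong-⇔ (≋-fol F μ)
  ≋-fol (F ∧f G) μ = ≋-fol F μ ×-⇔ ≋-fol G μ
  ≋-fol (∀f v F) = ≋-∀f v {F} {fol F} (≋-fol F)
  ≋-fol (box p F) μ = box≋elimBox p (fol F) (fol-FirstOrder F) μ ⇔-∘ ≋-box p {F} {fol F} (≋-fol F) μ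

mainTheorem16 : ExcludedMiddle 0ℓ →
    (Δ : DynamicTheory) → FiniteSupport Δ → FOLExpressive Δ →
    (F : DynamicTheory.Fml Δ) →
    Σ[ G ∈ DynamicTheory.Fml Δ ] (FirstOrder G × DynamicTheory.Valid Δ (F ⇔f G))
mainTheorem16 em Δ fs fe F = fol F , fol-FirstOrder F , ≋⇒Valid-⇔f {F} {fol F} (≋-fol F)
  where
  open Semantics em Δ
  open Elimination em Δ fs fe
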